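{- Let $G$ be a simple clopen game of length $\omega^2$ and let $B\subseteq \omega^{\omega\times\omega}$ be its payoff set (the set of runs of length $\omega^2$ won by Player I). Then $B$ is clopen in $\omega^{\omega\times\omega}$.
   Context: Runs of length $\omega^2$ are identified with elements of $\omega^{\omega^2}\cong(\omega^\omega)^\omega\cong\omega^{\omega\times\omega}$, carrying the product topology of the discrete space $\omega$; likewise $\omega^{\omega\cdot n}\cong(\omega^\omega)^n$. A subset $A\subseteq\omega^{\omega\cdot n}$ is identified with $\{x\in\omega^{\omega^2}: x\restriction\omega\cdot n\in A\}$. For a collection $\Gamma$ of such sets, the $\Gamma$-simple games of length $\omega^2$ (two players I and II alternate playing natural numbers) are generated as follows: (1) for each $n\in\omega$, a game decided after $\omega\cdot n$ moves (i.e. the winner depends only on the first $\omega\cdot n$ moves) whose payoff, restricted to sequences of length $\omega\cdot n$, lies in $\Gamma$, is $\Gamma$-simple; (2) if $n\in\omega$ and $G_i$ ($i\in\omega$) are $\Gamma$-simple, then the game in which I and II alternate for $\omega\cdot n$ moves, then Player I plays some $i\in\omega$, and then play continues according to the rules of $G_i$ (keeping the first $\omega\cdot n$ moves already played, but not $i$) is $\Gamma$-simple; (3) the same as (2) but with Player II choosing $i$. A game is simple clopen if it is $\Gamma$-simple for $\Gamma$ the clopen sets. -}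

module Defs where

open import Data.Nat using (ℕ; zero; suc; _≟_)
open import Data.Fin using (Fin; toℕ)
open import Data.Product using (_×_; _,_; Σ)
open import Data.List using (List)
open import Data.List.Membership.Propositional using (_∈_)
open import Relation.Binary.PropositionalEquality using (_≡_)
open import Relation.Nullary using (¬_; yes; no)

-- ω^I with the product topology of the discrete space ω.
-- A basic neighbourhood of x is determined by a finite list F of coordinates:
-- { y | y i ≡ x i for all i ∈ F }.
AgreeOn : {I : Set} → List I → (I → ℕ) → (I → ℕ) → Set
AgreeOn F x y = ∀ i → i ∈ F → y i ≡ x i

IsOpen : {I : Set} → ((I → ℕ) → Set) → Set
IsOpen {I} A = ∀ x → A x → Σ (List I) λ F → ∀ y → AgreeOn F x y → A y

IsClosed : {I : Set} → ((I → ℕ) → Set) → Set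
IsClosed A = IsOpen (λ x → ¬ A x)

IsClopen : {I : Set} → ((I → ℕ) → Set) → Set
IsClopen A = IsOpen A × IsClosed A

-- Runs of length ω²:  ω^{ω×ω}; coordinate (m , j) is move ω·m + j.
Run : Set
Run = ℕ × ℕ → ℕ

-- Sequences of length ω·n:  ω^{ω·n} ≅ ω^{n×ω}.
Run[_] : ℕ → Set
Run[ n ] = Fin n × ℕ → ℕ

restrict : (n : ℕ) → Run → Run[ n ]
restrict n x (k , j) = x (toℕ k , j)

-- Remove the move at position ω·n (the choice i), shifting the rest of
-- block n down by one; blocks other than n are unchanged.
-- (Reindexing of ω·n + 1 + α ↦ ω·n + α for the remaining play.)
dropAt : ℕ → Run → Run
dropAt n x (m , j) with m ≟ n
... | yes _ = x (m , suc j)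
... | no  _ = x (m , j)

data SimpleClopen : Set₁ where
  -- (1) decided after ω·n moves, payoff (restricted to length ω·n) clopen in ω^{ω·n}
  decided  : (n : ℕ) (A : Run[ n ] → Set) → IsClopen A → SimpleClopen
  -- (2) after ω·n moves Player I plays i, then continue with G i
  choiceI  : (n : ℕ) → (ℕ → SimpleClopen) → SimpleClopen
  choiceII : (n : ℕ) → (ℕ → SimpleClopen) → SimpleClopen

-- Payoff set (runs won by Player I). A run of a choice game is a run of
-- length ω·n + 1 + ω² = ω² whose move at position ω·n is the choice i.
payoff : SimpleClopen → Run → Set
payoff (decided n A _) x = A (restrict n x)
payoff (choiceI n G)   x = payoff (G (x (n , 0))) (dropAt n x)
payoff (choiceII n G)  x = payoff (G (x (n , 0))) (dropAt n x)

{-# OPTIONS --safe #-}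
module Submission where

-- Every continuous reindexing of coordinates pulls clopen sets back to clopen
-- sets, and a set whose section over each value of a single coordinate is
-- clopen is itself clopen. A choice game's payoff is the union, over the
-- choice i played at coordinate (n , 0), of the pullbacks of the payoffs of
-- the subgames G i along dropAt n; induction on the game gives the theorem.

open import Defs
open import Data.Nat using (ℕ; suc; _≟_)
open import Data.Fin using (toℕ)
open import Data.Product using (_×_; _,_; proj₁; proj₂)
open import Data.List using (map; _∷_)
open import Data.List.Membership.Propositional.Properties using (∈-map⁺)
open import Data.List.Relation.Unary.Any using (here; there)
open import Relation.Binary.PropositionalEquality using (_≡_; refl; sym; trans; subst)
open import Relation.Nullary using (yes; no)

reindex-open : {I J : Set} {A : (I → ℕ) → Set} (f : (J → ℕ) → I → ℕ) (g : I → J) →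
               (∀ x i → f x i ≡ x (g i)) → IsOpen A → IsOpen (λ x → A (f x))
reindex-open {A = A} f g f≡x∘g A-open x Afx with A-open (f x) Afx
... | F , nbhd = map g F , λ y y≈x → nbhd (f y) λ i i∈F →
  trans (f≡x∘g y i) (trans (y≈x (g i) (∈-map⁺ g i∈F)) (sym (f≡x∘g x i)))

reindex-clopen : {I J : Set} {A : (I → ℕ) → Set} (f : (J → ℕ) → I → ℕ) (g : I → J) →
                 (∀ x i → f x i ≡ x (g i)) → IsClopen A → IsClopen (λ x → A (f x))
reindex-clopen f g f≡x∘g (A-open , A-closed) =
  reindex-open f g f≡x∘g A-open , reindex-open f g f≡x∘g A-closed

branch-open : {J : Set} {Q : ℕ → (J → ℕ) → Set} (c : J) →
              (∀ i → IsOpen (Q i)) → IsOpen (λ x → Q (x c) x)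
branch-open {Q = Q} c Q-open x Qx with Q-open (x c) x Qx
... | F , nbhd = c ∷ F , λ y y≈x →
  subst (λ i → Q i y) (sym (y≈x c (here refl))) (nbhd y λ i i∈F → y≈x i (there i∈F))

branch-clopen : {J : Set} {Q : ℕ → (J → ℕ) → Set} (c : J) →
                (∀ i → IsClopen (Q i)) → IsClopen (λ x → Q (x c) x)
branch-clopen c Q-clopen =
  branch-open c (λ i → proj₁ (Q-clopen i)) , branch-open c (λ i → proj₂ (Q-clopen i))

dropIndex : ℕ → ℕ × ℕ → ℕ × ℕ
dropIndex n (m , j) with m ≟ n
... | yes _ = m , suc j
... | no  _ = m , j

dropAt-reindexes : ∀ n x p → dropAt n x p ≡ x (dropIndex n p)
dropAt-reindexes n x (m , j) with m ≟ n
... | yes _ = refl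
... | no  _ = refl

choice-clopen : (n : ℕ) {P : ℕ → Run → Set} → (∀ i → IsClopen (P i)) →
                IsClopen (λ x → P (x (n , 0)) (dropAt n x))
choice-clopen n P-clopen =
  branch-clopen (n , 0) λ i → reindex-clopen (dropAt n) (dropIndex n) (dropAt-reindexes n) (P-clopen i)

lemma2p3 : (G : SimpleClopen) → IsClopen (payoff G)
lemma2p3 (decided n A A-clopen) =
  reindex-clopen (restrict n) (λ (k , j) → toℕ k , j) (λ _ _ → refl) A-clopen
lemma2p3 (choiceI n G)  = choice-clopen n λ i → lemma2p3 (G i)
lemma2p3 (choiceII n G) = choice-clopen n λ i → lemma2p3 (G i)
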